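{- If $k\ge 4$ is an integer, then there is no graph $G$ with $\omega(G)=2$, $\chi(G)=k$ and $\chi_{\rho}(G)=k+1$; that is, the triple $(2,k,k+1)$ is not realizable.
   Context: All graphs are finite and simple. $\omega(G)$ is the clique number and $\chi(G)$ the chromatic number of $G$. For a positive integer $i$, an $i$-packing in $G$ is a set $W\subseteq V(G)$ such that any two distinct vertices of $W$ are at distance greater than $i$ in $G$. The packing chromatic number $\chi_{\rho}(G)$ is the smallest integer $k$ such that $V(G)$ can be partitioned into sets $V_1,\dots,V_k$ with $V_i$ an $i$-packing for each $i\in\{1,\dots,k\}$. A triple $(a,b,c)$ is realizable if some graph $G$ has $\omega(G)=a$, $\chi(G)=b$, $\chi_{\rho}(G)=c$. -}

module Defs where

open import Data.Nat using (ℕ; zero; suc; _≤_; _<_)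
open import Data.Fin using (Fin; toℕ)
open import Data.Bool using (Bool; true)
open import Data.Product using (Σ; ∃; _×_)
open import Relation.Nullary using (¬_)
open import Relation.Binary.PropositionalEquality using (_≡_; _≢_)
open import Function.Definitions using (Injective)

record Graph (n : ℕ) : Set where
  field
    adj   : Fin n → Fin n → Bool
    sym   : ∀ u v → adj u v ≡ adj v u
    irrefl : ∀ u → ¬ (adj u u ≡ true)
open Graph public

Adj : ∀ {n} → Graph n → Fin n → Fin n → Set
Adj G u v = adj G u v ≡ true

data Walk {n : ℕ} (G : Graph n) : ℕ → Fin n → Fin n → Set where
  here : ∀ {u} → Walk G zero u u
  step : ∀ {m u w v} → Adj G u w → Walk G m w v → Walk G (suc m) u v

DistLE : ∀ {n} → Graph n → ℕ → Fin n → Fin n → Set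
DistLE G i u v = ∃ λ m → m ≤ i × Walk G m u v

-- dist(u,v) > i  (includes dist = ∞ for different components)
DistGT : ∀ {n} → Graph n → ℕ → Fin n → Fin n → Set
DistGT G i u v = ¬ DistLE G i u v

Clique : ∀ {n} → Graph n → ℕ → Set
Clique {n} G a = Σ (Fin a → Fin n) λ f →
  Injective _≡_ _≡_ f × (∀ x y → x ≢ y → Adj G (f x) (f y))

CliqueNumber : ∀ {n} → Graph n → ℕ → Set
CliqueNumber G a = Clique G a × ¬ Clique G (suc a)

ProperColoring : ∀ {n} → Graph n → (k : ℕ) → Set
ProperColoring {n} G k = Σ (Fin n → Fin k) λ c →
  ∀ u v → Adj G u v → c u ≢ c v

ChromaticNumber : ∀ {n} → Graph n → ℕ → Set
ChromaticNumber G k = ProperColoring G k × (∀ j → j < k → ¬ ProperColoring G j)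

IsPacking : ∀ {n} → Graph n → ℕ → (Fin n → Set) → Set
IsPacking G i W = ∀ u v → W u → W v → u ≢ v → DistGT G i u v

-- packing colouring with k colours: colour j : Fin k stands for class V_{toℕ j + 1},
-- which must be a (toℕ j + 1)-packing
PackingColoring : ∀ {n} → Graph n → (k : ℕ) → Set
PackingColoring {n} G k = Σ (Fin n → Fin k) λ c →
  ∀ (j : Fin k) → IsPacking G (suc (toℕ j)) (λ v → c v ≡ j)

PackingChromaticNumber : ∀ {n} → Graph n → ℕ → Set
PackingChromaticNumber G k =
  PackingColoring G k × (∀ j → j < k → ¬ PackingColoring G j)

Realizable : ℕ → ℕ → ℕ → Set
Realizable a b c = Σ ℕ λ n → Σ (Graph n) λ G →
  CliqueNumber G a × ChromaticNumber G b × PackingChromaticNumber G c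

module Submission where

-- Let G be triangle-free with a packing colouring by classes V₁,…,V_{k+1}.  We
-- build a proper colouring with k − 1 colours, contradicting χ(G) = k.  Let H be
-- the subgraph of G induced by the "middle" classes V₂ ∪ … ∪ V₅.
--  (1) Along a path of H a class V_{a+1} cannot recur within a + 1 steps, since
--      it is an (a+1)-packing: the sequence of packing indices is "spaced".  An
--      exhaustive search shows that spaced sequences over {1,2,3,4} have length
--      at most 8, and that no cyclic sequence of length 5 or 7 is spaced in all
--      of its rotations.
--  (2) Hence paths of H have at most 7 edges and H has no odd cycle (length 1:
--      irreflexivity, 3: triangle-freeness, 5 and 7: the search, ≥ 9: (1)).
--  (3) A finite graph whose paths are bounded and which has no odd cycle is
--      2-colourable: colour a vertex by the parity of a walk to it from the least
--      vertex of its component.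
--  (4) V₁, the two sides of H and the classes V₆,…,V_{k+1} give k − 1 colours.

open import Defs hiding (sym)
open import Data.Nat using (ℕ; zero; suc; _+_; _≤_; _<_; z≤n; s≤s; _≤?_; _≡ᵇ_)
open import Data.Nat.Properties
  using ( ≡ᵇ⇒≡; suc-injective; +-comm; ≤-pred; ≤-antisym; ≤⇒≯; ≰⇒>; <-≤-trans; n<1+n
        ; m<m+n; m<n+m; m≤m+n; m≤n⇒m⊓n≡m)
open import Data.Nat.Tactic.RingSolver using (solve-∀)
open import Data.Fin using (Fin; zero; suc; toℕ; fromℕ<; _≟_)
open import Data.Fin.Properties using (toℕ-injective; toℕ-fromℕ<; any?)
open import Data.Bool using (Bool; true; false; T; T?; not; _∧_; _∨_; _xor_; if_then_else_)
open import Data.Bool.Properties using (T-∧; not-distribˡ-xor) renaming (_≟_ to _≟ᵇ_)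
open import Data.List using (List; []; _∷_; _++_; [_]; length; map; take; drop)
open import Data.List.Properties
  using (length-++; length-map; length-take; take++drop≡id; ++-assoc; ++-identityʳ; map-++)
open import Data.List.Relation.Unary.All using (All; []; _∷_)
import Data.List.Relation.Unary.All.Properties as All
import Data.List.Relation.Unary.Any as Any
open import Data.List.Relation.Unary.Any using (here; there)
open import Data.List.Membership.Propositional using (_∈_)
open import Data.List.Membership.Propositional.Properties using (∈-∃++; ∈-++⁻)
open import Data.Product using (Σ-syntax; ∃; ∃-syntax; _×_; _,_; proj₁; proj₂)
open import Data.Sum using (_⊎_; inj₁; inj₂) renaming ([_,_] to either)
open import Data.Sum.Properties using (inj₁-injective; inj₂-injective)
open import Data.Empty using (⊥)
open import Data.Unit using (tt)
open import Function using (_∘_)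
open import Function.Bundles using (Equivalence)
open import Function.Definitions using (Injective)
open import Relation.Nullary using (¬_; Dec; yes; no; contradiction)
open import Relation.Nullary.Decidable using (_×-dec_; _⊎-dec_)
open import Relation.Binary.Definitions using (DecidableEquality)
open import Relation.Binary.PropositionalEquality
  using (_≡_; _≢_; refl; sym; trans; cong; cong₂; subst; module ≡-Reasoning)

open Equivalence using (to; from)

T-not : ∀ b → T b → ¬ T (not b)
T-not true _ ()

-- Spaced sequences of packing indices.  Index a stands for the class V_{a+1},
-- an (a+1)-packing; the middle indices 1,…,4 are the classes V₂,…,V₅.

isMid : ℕ → Bool
isMid 1 = true
isMid 2 = true
isMid 3 = true
isMid 4 = true
isMid _ = false

Mid : ℕ → Set
Mid a = T (isMid a)

allMid : (ℕ → Bool) → Bool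
allMid f = f 1 ∧ f 2 ∧ f 3 ∧ f 4

allMid-elim : ∀ f {a} → Mid a → T (allMid f) → T (f a)
allMid-elim f {1} _ t = proj₁ (to (T-∧ {f 1}) t)
allMid-elim f {2} _ t = proj₁ (to (T-∧ {f 2}) (proj₂ (to (T-∧ {f 1}) t)))
allMid-elim f {3} _ t =
  proj₁ (to (T-∧ {f 3}) (proj₂ (to (T-∧ {f 2}) (proj₂ (to (T-∧ {f 1}) t)))))
allMid-elim f {4} _ t =
  proj₂ (to (T-∧ {f 3}) (proj₂ (to (T-∧ {f 2}) (proj₂ (to (T-∧ {f 1}) t)))))

occursWithin : ℕ → ℕ → List ℕ → Bool
occursWithin zero    a xs       = false
occursWithin (suc w) a []       = false
occursWithin (suc w) a (x ∷ xs) = (a ≡ᵇ x) ∨ occursWithin w a xs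

occursWithin-++ : ∀ w a xs ys → T (occursWithin w a xs) → T (occursWithin w a (xs ++ ys))
occursWithin-++ (suc w) a (x ∷ xs) ys t with a ≡ᵇ x
... | true  = tt
... | false = occursWithin-++ w a xs ys t

spaced : List ℕ → Bool
spaced []       = true
spaced (a ∷ xs) = if occursWithin (suc a) a xs then false else spaced xs

spaced-∷⁻ : ∀ a xs → T (spaced (a ∷ xs)) → ¬ T (occursWithin (suc a) a xs) × T (spaced xs)
spaced-∷⁻ a xs s with occursWithin (suc a) a xs
... | false = (λ ()) , s

spaced-∷⁺ : ∀ {a xs} → ¬ T (occursWithin (suc a) a xs) → T (spaced xs) → T (spaced (a ∷ xs))
spaced-∷⁺ {a} {xs} new s with occursWithin (suc a) a xs
... | true  = new tt
... | false = s

spaced-prefix : ∀ xs ys → T (spaced (xs ++ ys)) → T (spaced xs)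
spaced-prefix []       ys _ = tt
spaced-prefix (a ∷ xs) ys s =
  let new , rest = spaced-∷⁻ a (xs ++ ys) s
  in spaced-∷⁺ {a} {xs} (new ∘ occursWithin-++ (suc a) a xs ys) (spaced-prefix xs ys rest)

search : (List ℕ → Bool) → ℕ → List ℕ → Bool
search leaf zero    xs = leaf xs
search leaf (suc d) xs =
  if spaced xs then allMid (λ a → search leaf d (xs ++ [ a ])) else true

search-sound : ∀ leaf d xs ys → T (search leaf d xs) → All Mid ys → length ys ≡ d →
               T (spaced (xs ++ ys)) → T (leaf (xs ++ ys))
search-sound leaf zero xs [] t [] refl _ = subst (T ∘ leaf) (sym (++-identityʳ xs)) t
search-sound leaf (suc d) xs (y ∷ ys) t (my ∷ mys) refl s
  with spaced xs | spaced-prefix xs (y ∷ ys) s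
... | false | ()
... | true  | _ =
  subst (T ∘ leaf) (++-assoc xs [ y ] ys)
    (search-sound leaf d (xs ++ [ y ]) ys
      (allMid-elim (λ a → search leaf d (xs ++ [ a ])) my t) mys refl
      (subst (T ∘ spaced) (sym (++-assoc xs [ y ] ys)) s))

noSpaced9 : T (search (not ∘ spaced) 9 [])
noSpaced9 = tt

spaced-short : ∀ ys → All Mid ys → T (spaced ys) → length ys < 9
spaced-short ys mids s with 9 ≤? length ys
... | no 9≰ = ≰⇒> 9≰
... | yes 9≤ = contradiction (search-sound (not ∘ spaced) 9 [] (take 9 ys) noSpaced9
                               (All.take⁺ 9 mids) length9 prefixSpaced)
                             (T-not (spaced (take 9 ys)) prefixSpaced)
  where
  length9 : length (take 9 ys) ≡ 9
  length9 = trans (length-take 9 ys) (m≤n⇒m⊓n≡m 9≤)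
  prefixSpaced : T (spaced (take 9 ys))
  prefixSpaced = spaced-prefix (take 9 ys) (drop 9 ys)
                   (subst (T ∘ spaced) (sym (take++drop≡id 9 ys)) s)

rotate : ∀ {A : Set} → List A → List A
rotate []       = []
rotate (x ∷ xs) = xs ++ [ x ]

rotateBy : ∀ {A : Set} → ℕ → List A → List A
rotateBy zero    xs = xs
rotateBy (suc r) xs = rotateBy r (rotate xs)

map-rotateBy : ∀ {A B : Set} (f : A → B) r xs → map f (rotateBy r xs) ≡ rotateBy r (map f xs)
map-rotateBy f zero    xs       = refl
map-rotateBy f (suc r) []       = map-rotateBy f r []
map-rotateBy f (suc r) (x ∷ xs) =
  trans (map-rotateBy f r (xs ++ [ x ])) (cong (rotateBy r) (map-++ f xs [ x ]))

rotationsSpaced : ℕ → List ℕ → Bool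
rotationsSpaced zero    xs = true
rotationsSpaced (suc L) xs = spaced xs ∧ rotationsSpaced L (rotate xs)

rotationsSpaced-intro : ∀ L xs → (∀ r → T (spaced (rotateBy r xs))) → T (rotationsSpaced L xs)
rotationsSpaced-intro zero    xs _ = tt
rotationsSpaced-intro (suc L) xs s =
  from T-∧ (s 0 , rotationsSpaced-intro L (rotate xs) (s ∘ suc))

noSpacedCycle5 : T (search (not ∘ rotationsSpaced 5) 5 [])
noSpacedCycle5 = tt

noSpacedCycle7 : T (search (not ∘ rotationsSpaced 7) 7 [])
noSpacedCycle7 = tt

rotationsNotSpaced : ∀ ys → All Mid ys → length ys ≡ 5 ⊎ length ys ≡ 7 →
                     ¬ (∀ r → T (spaced (rotateBy r ys)))
rotationsNotSpaced ys mids (inj₁ len) s =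
  T-not _ (rotationsSpaced-intro 5 ys s)
    (search-sound (not ∘ rotationsSpaced 5) 5 [] ys noSpacedCycle5 mids len (s 0))
rotationsNotSpaced ys mids (inj₂ len) s =
  T-not _ (rotationsSpaced-intro 7 ys s)
    (search-sound (not ∘ rotationsSpaced 7) 7 [] ys noSpacedCycle7 mids len (s 0))

odd : ℕ → Bool
odd zero    = false
odd (suc n) = not (odd n)

odd-+ : ∀ m n → odd (m + n) ≡ odd m xor odd n
odd-+ zero    n = refl
odd-+ (suc m) n = trans (cong not (odd-+ m n)) (not-distribˡ-xor (odd m) (odd n))

xor-T : ∀ a b → T (a xor b) → T a ⊎ T b
xor-T true  _ _ = inj₁ tt
xor-T false _ t = inj₂ t

xor-not-self : ∀ a → T (a xor not a)
xor-not-self true  = tt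
xor-not-self false = tt

module _ {A : Set} where

  Dup : List A → Set
  Dup []       = ⊥
  Dup (x ∷ xs) = x ∈ xs ⊎ Dup xs

  dup? : DecidableEquality A → ∀ xs → Dec (Dup xs)
  dup? _≟ₐ_ []       = no λ ()
  dup? _≟ₐ_ (x ∷ xs) = Any.any? (x ≟ₐ_) xs ⊎-dec dup? _≟ₐ_ xs

  dup-split : ∀ xs → Dup xs → ∃[ as ] ∃[ y ] ∃[ bs ] ∃[ cs ] xs ≡ as ++ y ∷ bs ++ y ∷ cs
  dup-split (x ∷ xs) (inj₁ x∈xs) with bs , cs , refl ← ∈-∃++ x∈xs = [] , x , bs , cs , refl
  dup-split (x ∷ xs) (inj₂ d) with as , y , bs , cs , refl ← dup-split xs d =
    x ∷ as , y , bs , cs , refl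

  dup-++ʳ : ∀ as {bs} → Dup bs → Dup (as ++ bs)
  dup-++ʳ []       d = d
  dup-++ʳ (a ∷ as) d = inj₂ (dup-++ʳ as d)

  dup-snoc : ∀ w xs → Dup (xs ++ [ w ]) → Dup (w ∷ xs)
  dup-snoc w (y ∷ ys) (inj₁ y∈) with ∈-++⁻ ys y∈
  ... | inj₁ y∈ys        = inj₂ (inj₁ y∈ys)
  ... | inj₂ (here refl) = inj₁ (here refl)
  dup-snoc w []       (inj₁ ())
  dup-snoc w []       (inj₂ ())
  dup-snoc w (y ∷ ys) (inj₂ d) with dup-snoc w ys d
  ... | inj₁ w∈ys = inj₁ (there w∈ys)
  ... | inj₂ d′   = inj₂ (inj₂ d′)

  dup-rotateBy : ∀ r xs → Dup (rotateBy r xs) → Dup xs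
  dup-rotateBy zero    xs       d = d
  dup-rotateBy (suc r) []       d = dup-rotateBy r [] d
  dup-rotateBy (suc r) (x ∷ xs) d = dup-snoc x xs (dup-rotateBy r (xs ++ [ x ]) d)

-- Chains: walks along a relation, recorded by the list of vertices after the start.

module Chains {A : Set} (_~_ : A → A → Set) (_≟ₐ_ : DecidableEquality A) where

  Chain : A → List A → A → Set
  Chain u []       v = u ≡ v
  Chain u (w ∷ ws) v = u ~ w × Chain w ws v

  chain-++ : ∀ {u v w} xs {ys} → Chain u xs v → Chain v ys w → Chain u (xs ++ ys) w
  chain-++ []       refl     q = q
  chain-++ (x ∷ xs) (ux , p) q = ux , chain-++ xs p q

  chain-split : ∀ {u v} xs {y ys} → Chain u (xs ++ y ∷ ys) v → Chain u (xs ++ [ y ]) y × Chain y ys v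
  chain-split []       (uy , p) = (uy , refl) , p
  chain-split (x ∷ xs) (ux , p) = let p₁ , p₂ = chain-split xs p in (ux , p₁) , p₂

  chain-All : ∀ {P : A → Set} → (∀ {u w} → u ~ w → P w) → ∀ {u v} ws → Chain u ws v → All P ws
  chain-All f []       _        = []
  chain-All f (w ∷ ws) (uw , p) = f uw ∷ chain-All f ws p

  chain-reverse : (∀ {u w} → u ~ w → w ~ u) → ∀ {u v} ws → Chain u ws v →
                  ∃[ ws′ ] length ws′ ≡ length ws × Chain v ws′ u
  chain-reverse ~-sym     []       refl     = [] , refl , refl
  chain-reverse ~-sym {u} (w ∷ ws) (uw , p) with ws′ , len , q ← chain-reverse ~-sym ws p =
    ws′ ++ [ u ] , trans (length-++ ws′) (trans (+-comm (length ws′) 1) (cong suc len)) ,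
    chain-++ ws′ q (~-sym uw , refl)

  chain-rotateBy : ∀ r {x} ws → Chain x ws x → ∃[ y ] Chain y (rotateBy r ws) y
  chain-rotateBy zero    {x} ws       p        = x , p
  chain-rotateBy (suc r) {x} []       refl     = chain-rotateBy r {x} [] refl
  chain-rotateBy (suc r)     (w ∷ ws) (xw , p) =
    chain-rotateBy r (ws ++ [ w ]) (chain-++ ws p (xw , refl))

  erase : ∀ {u v} ws → Chain u ws v → ∃[ ws′ ] Chain u ws′ v × ¬ Dup (u ∷ ws′)
  erase []           refl = [] , refl , λ { (inj₁ ()) ; (inj₂ ()) }
  erase {u} (w ∷ ws) (uw , p) with ws′ , p′ , noDup ← erase ws p with Any.any? (u ≟ₐ_) (w ∷ ws′)
  ... | no u∉ = w ∷ ws′ , (uw , p′) , either u∉ noDup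
  ... | yes u∈ with bs , cs , split ← ∈-∃++ u∈ =
    cs , proj₂ (chain-split bs (subst (λ l → Chain u l _) split (uw , p′))) ,
    noDup ∘ subst Dup (sym split) ∘ dup-++ʳ bs

  cutLoop : ∀ {x z} ws → Chain x ws z → Dup ws →
            ∃[ y ] ∃[ loop ] ∃[ rest ] Chain y loop y × Chain x rest z ×
              length loop + length rest ≡ length ws × 0 < length loop × 0 < length rest
  cutLoop ws p d with as , y , bs , cs , refl ← dup-split ws d =
    let p₁ , p₂₃ = chain-split as p
        p₂ , p₃  = chain-split bs p₂₃
    in y , bs ++ [ y ] , (as ++ [ y ]) ++ cs , p₂ , chain-++ (as ++ [ y ]) p₁ p₃ ,
       lengths , positive bs , positive′
    where
    open ≡-Reasoning
    shuffle : ∀ a b c → (b + 1) + ((a + 1) + c) ≡ a + suc (b + suc c)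
    shuffle = solve-∀
    lengths : length (bs ++ [ y ]) + length ((as ++ [ y ]) ++ cs) ≡ length (as ++ y ∷ bs ++ y ∷ cs)
    lengths = begin
      length (bs ++ [ y ]) + length ((as ++ [ y ]) ++ cs)
        ≡⟨ cong₂ _+_ (length-++ bs) (trans (length-++ (as ++ [ y ])) (cong (_+ length cs) (length-++ as))) ⟩
      (length bs + 1) + ((length as + 1) + length cs)
        ≡⟨ shuffle (length as) (length bs) (length cs) ⟩
      length as + suc (length bs + suc (length cs))
        ≡⟨ sym (trans (length-++ as) (cong (λ l → length as + suc l) (length-++ bs))) ⟩
      length (as ++ y ∷ bs ++ y ∷ cs) ∎
    positive : ∀ xs → 0 < length (xs ++ [ y ])
    positive []       = s≤s z≤n
    positive (_ ∷ _)  = s≤s z≤n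
    positive′ : 0 < length ((as ++ [ y ]) ++ cs)
    positive′ = subst (0 <_) (sym (length-++ (as ++ [ y ]))) (<-≤-trans (positive as) (m≤m+n _ _))

  oddCycle : ∀ {x} ws → Chain x ws x → T (odd (length ws)) →
             ∃[ y ] ∃[ cs ] Chain y cs y × ¬ Dup cs × T (odd (length cs))
  oddCycle ws = shrink (suc (length ws)) ws (n<1+n _)
    where
    shrink : ∀ N {x} ws → length ws < N → Chain x ws x → T (odd (length ws)) →
             ∃[ y ] ∃[ cs ] Chain y cs y × ¬ Dup cs × T (odd (length cs))
    shrink N ws _ p o with dup? _≟ₐ_ ws
    ... | no noDup = _ , ws , p , noDup , o
    shrink (suc N) ws lt p o | yes d
      with y , loop , rest , pl , pr , len , 0<l , 0<r ← cutLoop ws p d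
      with xor-T (odd (length loop)) (odd (length rest))
             (subst T (trans (cong odd (sym len)) (odd-+ (length loop) (length rest))) o)
    ... | inj₁ oddLoop =
      shrink N loop (<-≤-trans (subst (_ <_) len (m<m+n _ 0<r)) (≤-pred lt)) pl oddLoop
    ... | inj₂ oddRest =
      shrink N rest (<-≤-trans (subst (_ <_) len (m<n+m _ 0<l)) (≤-pred lt)) pr oddRest

least : ∀ {m} {P : Fin m → Set} → (∀ i → Dec (P i)) → ∃ P →
        Σ[ j ∈ Fin m ] P j × (∀ i → P i → toℕ j ≤ toℕ i)
least {suc m} P? w with P? zero
... | yes p₀ = zero , p₀ , λ _ _ → z≤n
least {suc m} P? (zero  , p) | no ¬p₀ = contradiction p ¬p₀
least {suc m} P? (suc i , p) | no ¬p₀ with j , pj , minimal ← least (P? ∘ suc) (i , p) =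
  suc j , pj , λ { zero q → contradiction q ¬p₀ ; (suc i) q → s≤s (minimal i q) }

module TwoColouring {n : ℕ} (_~_ : Fin n → Fin n → Set)
  (~-sym : ∀ {u v} → u ~ v → v ~ u) (_~?_ : ∀ u v → Dec (u ~ v)) (B : ℕ)
  (pathsShort : ∀ {u v} ws → Chains.Chain _~_ _≟_ u ws v → ¬ Dup (u ∷ ws) → length ws < B)
  (noOddCycle : ∀ {x} ws → Chains.Chain _~_ _≟_ x ws x → ¬ Dup ws → ¬ T (odd (length ws)))
  where

  open Chains _~_ _≟_

  noOddClosedChain : ∀ {x} ws → Chain x ws x → ¬ T (odd (length ws))
  noOddClosedChain ws p o with _ , cs , q , noDup , oddCs ← oddCycle ws p o =
    noOddCycle cs q noDup oddCs

  ChainOfLength : ℕ → Fin n → Fin n → Set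
  ChainOfLength m u v = ∃[ ws ] length ws ≡ m × Chain u ws v

  chainOfLength? : ∀ m u v → Dec (ChainOfLength m u v)
  chainOfLength? zero u v with u ≟ v
  ... | yes u≡v = yes ([] , refl , u≡v)
  ... | no  u≢v = no λ { ([] , _ , u≡v) → u≢v u≡v ; (_ ∷ _ , () , _) }
  chainOfLength? (suc m) u v with any? (λ w → (u ~? w) ×-dec chainOfLength? m w v)
  ... | yes (w , uw , ws , len , p) = yes (w ∷ ws , cong suc len , uw , p)
  ... | no ¬step = no λ { ([] , () , _)
                        ; (w ∷ ws , len , uw , p) → ¬step (w , uw , ws , suc-injective len , p) }

  Reach : Fin n → Fin n → Set
  Reach u v = Σ[ i ∈ Fin B ] ChainOfLength (toℕ i) u v

  reach : ∀ {u v} ws → Chain u ws v → Reach u v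
  reach ws p with ws′ , p′ , noDup ← erase ws p =
    fromℕ< (pathsShort ws′ p′ noDup) , ws′ , sym (toℕ-fromℕ< _) , p′

  reach-step : ∀ {r u v} → Reach r u → u ~ v → Reach r v
  reach-step (_ , ws , _ , p) uv = reach (ws ++ [ _ ]) (chain-++ ws p (uv , refl))

  rooted : ∀ v → Σ[ r ∈ Fin n ] Reach r v × (∀ u → Reach u v → toℕ r ≤ toℕ u)
  rooted v = least (λ u → any? λ i → chainOfLength? (toℕ i) u v) (v , reach [] refl)

  root : Fin n → Fin n
  root v = proj₁ (rooted v)

  root-adj : ∀ {u v} → u ~ v → root u ≡ root v
  root-adj {u} {v} uv with _ , reachU , minimalU ← rooted u | _ , reachV , minimalV ← rooted v =
    toℕ-injective (≤-antisym (minimalU _ (reach-step reachV (~-sym uv)))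
                             (minimalV _ (reach-step reachU uv)))

  rootChain : ∀ v → ∃[ ws ] Chain (root v) ws v
  rootChain v with _ , ws , _ , p ← proj₁ (proj₂ (rooted v)) = ws , p

  -- two chains from a common vertex to adjacent vertices differ in parity,
  -- otherwise they close up to an odd closed chain
  parity-differs : ∀ {r u v} us vs → Chain r us u → Chain r vs v → u ~ v →
                   odd (length us) ≢ odd (length vs)
  parity-differs {v = v} us vs pu pv uv same with vs′ , len , pv′ ← chain-reverse ~-sym vs pv =
    noOddClosedChain (us ++ v ∷ vs′) (chain-++ us pu (uv , pv′))
      (subst T (sym oddLength) (xor-not-self (odd (length vs))))
    where
    open ≡-Reasoning
    oddLength : odd (length (us ++ v ∷ vs′)) ≡ odd (length vs) xor not (odd (length vs))
    oddLength = begin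
      odd (length (us ++ v ∷ vs′))           ≡⟨ cong odd (length-++ us) ⟩
      odd (length us + suc (length vs′))     ≡⟨ odd-+ (length us) (suc (length vs′)) ⟩
      odd (length us) xor not (odd (length vs′))
        ≡⟨ cong₂ (λ a b → a xor not b) same (cong odd len) ⟩
      odd (length vs) xor not (odd (length vs)) ∎

  colour : Fin n → Bool
  colour v = odd (length (proj₁ (rootChain v)))

  colour-proper : ∀ {u v} → u ~ v → colour u ≢ colour v
  colour-proper {u} {v} uv =
    parity-differs (proj₁ (rootChain u)) (proj₁ (rootChain v)) (proj₂ (rootChain u))
      (subst (λ r → Chain r _ v) (sym (root-adj uv)) (proj₂ (rootChain v))) uv

adj-sym : ∀ {n} (G : Graph n) {u v} → Adj G u v → Adj G v u
adj-sym G {u} {v} uv = trans (Graph.sym G v u) uv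

adj-distinct : ∀ {n} (G : Graph n) {u v} → Adj G u v → u ≢ v
adj-distinct G {u} uv refl = irrefl G u uv

adjacent⇒injective : ∀ {n a} (G : Graph n) (f : Fin a → Fin n) →
                     (∀ i j → i ≢ j → Adj G (f i) (f j)) → Injective _≡_ _≡_ f
adjacent⇒injective G f adjacent {i} {j} fi≡fj with i ≟ j
... | yes i≡j = i≡j
... | no  i≢j = contradiction fi≡fj (adj-distinct G (adjacent i j i≢j))

triangleFree : ∀ {n} (G : Graph n) → ¬ Clique G 3 →
               ∀ x y z → Adj G x y → Adj G y z → Adj G x z → ⊥
triangleFree {n} G noK₃ x y z xy yz xz = noK₃ (f , adjacent⇒injective G f adjacent , adjacent)
  where
  f : Fin 3 → Fin n
  f zero             = x
  f (suc zero)       = y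
  f (suc (suc zero)) = z
  adjacent : ∀ i j → i ≢ j → Adj G (f i) (f j)
  adjacent zero             (suc zero)       _ = xy
  adjacent zero             (suc (suc zero)) _ = xz
  adjacent (suc zero)       zero             _ = adj-sym G xy
  adjacent (suc zero)       (suc (suc zero)) _ = yz
  adjacent (suc (suc zero)) zero             _ = adj-sym G xz
  adjacent (suc (suc zero)) (suc zero)       _ = adj-sym G yz
  adjacent zero             zero             i≢i = contradiction refl i≢i
  adjacent (suc zero)       (suc zero)       i≢i = contradiction refl i≢i
  adjacent (suc (suc zero)) (suc (suc zero)) i≢i = contradiction refl i≢i

IsPackingColouring : ∀ {n K} → Graph n → (Fin n → Fin K) → Set
IsPackingColouring G c = ∀ j → IsPacking G (suc (toℕ j)) (λ v → c v ≡ j)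

packing-proper : ∀ {n K} (G : Graph n) (c : Fin n → Fin K) → IsPackingColouring G c →
                 ∀ {u v} → Adj G u v → c u ≢ c v
packing-proper G c packing {u} {v} uv cu≡cv =
  packing (c u) u v refl (sym cu≡cv) (adj-distinct G uv) (1 , s≤s z≤n , step uv here)

module MiddleClasses {n K : ℕ} (G : Graph n) (c : Fin n → Fin K)
  (packing : IsPackingColouring G c)
  (noTriangle : ∀ x y z → Adj G x y → Adj G y z → Adj G x z → ⊥) where

  index : Fin n → ℕ
  index v = toℕ (c v)

  _~_ : Fin n → Fin n → Set
  u ~ w = Adj G u w × Mid (index u) × Mid (index w)

  ~-sym : ∀ {u w} → u ~ w → w ~ u
  ~-sym (uw , mu , mw) = adj-sym G uw , mw , mu

  _~?_ : ∀ u w → Dec (u ~ w)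
  u ~? w = (adj G u w ≟ᵇ true) ×-dec T? (isMid (index u)) ×-dec T? (isMid (index w))

  open Chains _~_ _≟_

  middle : ∀ {u v} ws → Chain u ws v → All Mid (map index ws)
  middle ws p = All.map⁺ (chain-All (proj₂ ∘ proj₂) ws p)

  nearOccurrence : ∀ {u v} w a ws → Chain u ws v → T (occursWithin w a (map index ws)) →
                   ∃[ y ] y ∈ ws × index y ≡ a × DistLE G w u y
  nearOccurrence (suc w) a (x ∷ xs) ((ux , _) , p) t with a ≡ᵇ index x in a≡ᵇ
  ... | true  =
    x , here refl , sym (≡ᵇ⇒≡ a (index x) (subst T (sym a≡ᵇ) tt)) , 1 , s≤s z≤n , step ux here
  ... | false with y , y∈ , iy , m , m≤w , walk ← nearOccurrence w a xs p t =
    y , there y∈ , iy , suc m , s≤s m≤w , step ux walk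

  -- Along a path of H the index sequence is spaced: index a recurring within a + 1
  -- steps would put two vertices of the (a+1)-packing at distance at most a + 1.
  spacedPath : ∀ {u v} ws → Chain u ws v → ¬ Dup (u ∷ ws) → T (spaced (index u ∷ map index ws))
  spacedTail : ∀ {u v} ws → Chain u ws v → ¬ Dup ws → T (spaced (map index ws))

  spacedPath {u} ws p noDup =
    spaced-∷⁺ {index u} {map index ws} noRepeat (spacedTail ws p (noDup ∘ inj₂))
    where
    noRepeat : ¬ T (occursWithin (suc (index u)) (index u) (map index ws))
    noRepeat t with y , y∈ , iy , near ← nearOccurrence (suc (index u)) (index u) ws p t =
      packing (c u) u y refl (toℕ-injective iy) (λ { refl → noDup (inj₁ y∈) }) near

  spacedTail []       _       _     = tt
  spacedTail (w ∷ ws) (_ , p) noDup = spacedPath ws p noDup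

  pathsShort : ∀ {u v} ws → Chain u ws v → ¬ Dup (u ∷ ws) → length ws < 8
  pathsShort []           _            _     = s≤s z≤n
  pathsShort {u} (w ∷ ws) p@((_ , mu , _) , _) noDup =
    subst (_< 8) (length-map index (w ∷ ws))
      (≤-pred (spaced-short (index u ∷ map index (w ∷ ws)) (mu ∷ middle (w ∷ ws) p)
                            (spacedPath (w ∷ ws) p noDup)))

  cycleSpaced : ∀ {x} ws → Chain x ws x → ¬ Dup ws → ∀ r → T (spaced (rotateBy r (map index ws)))
  cycleSpaced ws p noDup r with _ , q ← chain-rotateBy r ws p =
    subst (T ∘ spaced) (map-rotateBy index r ws)
      (spacedTail (rotateBy r ws) q (noDup ∘ dup-rotateBy r ws))

  noOddCycle : ∀ {x} ws → Chain x ws x → ¬ Dup ws → ¬ T (odd (length ws))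
  noOddCycle (_ ∷ []) ((xx , _) , refl) _ _ = adj-distinct G xx refl
  noOddCycle (a ∷ b ∷ _ ∷ []) ((xa , _) , (ab , _) , (bx , _) , refl) _ _ =
    noTriangle _ a b xa ab (adj-sym G bx)
  noOddCycle ws@(_ ∷ _ ∷ _ ∷ _ ∷ _ ∷ []) p noDup _ =
    rotationsNotSpaced (map index ws) (middle ws p) (inj₁ refl) (cycleSpaced ws p noDup)
  noOddCycle ws@(_ ∷ _ ∷ _ ∷ _ ∷ _ ∷ _ ∷ _ ∷ []) p noDup _ =
    rotationsNotSpaced (map index ws) (middle ws p) (inj₂ refl) (cycleSpaced ws p noDup)
  noOddCycle ws@(_ ∷ _ ∷ _ ∷ _ ∷ _ ∷ _ ∷ _ ∷ _ ∷ _ ∷ _) p noDup _ =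
    ≤⇒≯ (s≤s (s≤s (s≤s (s≤s (s≤s (s≤s (s≤s (s≤s (s≤s z≤n)))))))))
        (spaced-short (map index ws) (middle ws p) (cycleSpaced ws p noDup 0))
  noOddCycle [] _ _ ()
  noOddCycle (_ ∷ _ ∷ []) _ _ ()
  noOddCycle (_ ∷ _ ∷ _ ∷ _ ∷ []) _ _ ()
  noOddCycle (_ ∷ _ ∷ _ ∷ _ ∷ _ ∷ _ ∷ []) _ _ ()
  noOddCycle (_ ∷ _ ∷ _ ∷ _ ∷ _ ∷ _ ∷ _ ∷ _ ∷ []) _ _ ()

  open TwoColouring _~_ ~-sym _~?_ 8 pathsShort noOddCycle public using (colour; colour-proper)

-- Recolouring.  V₁ keeps colour 0, the middle classes V₂,…,V₅ get colour 1 or 2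
-- according to their side in H, and V_{6+j} gets colour 3 + j.

side : ∀ {m} → Bool → Fin (3 + m)
side true  = suc zero
side false = suc (suc zero)

merge : ∀ {m} → Fin (5 + m) → Bool → Fin (3 + m)
merge zero                            _ = zero
merge (suc zero)                      b = side b
merge (suc (suc zero))                b = side b
merge (suc (suc (suc zero)))          b = side b
merge (suc (suc (suc (suc zero))))    b = side b
merge (suc (suc (suc (suc (suc j))))) _ = suc (suc (suc j))

unmerge : ∀ {m} → Fin (3 + m) → Fin (5 + m) ⊎ Bool
unmerge zero                = inj₁ zero
unmerge (suc zero)          = inj₂ true
unmerge (suc (suc zero))    = inj₂ false
unmerge (suc (suc (suc j))) = inj₁ (suc (suc (suc (suc (suc j)))))

unmerge-side : ∀ {m} b → unmerge {m} (side b) ≡ inj₂ b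
unmerge-side true  = refl
unmerge-side false = refl

unmerge-merge : ∀ {m} (a : Fin (5 + m)) b →
                unmerge (merge a b) ≡ (if isMid (toℕ a) then inj₂ b else inj₁ a)
unmerge-merge zero                            b = refl
unmerge-merge (suc zero)                      b = unmerge-side b
unmerge-merge (suc (suc zero))                b = unmerge-side b
unmerge-merge (suc (suc (suc zero)))          b = unmerge-side b
unmerge-merge (suc (suc (suc (suc zero))))    b = unmerge-side b
unmerge-merge (suc (suc (suc (suc (suc j))))) b = refl

if-inj : ∀ {A B : Set} p p′ (a a′ : A) (b b′ : B) →
         (if p then inj₂ b else inj₁ a) ≡ (if p′ then inj₂ b′ else inj₁ a′) →
         a ≡ a′ ⊎ (T p × T p′ × b ≡ b′)
if-inj true  true  _ _ _ _ e = inj₂ (tt , tt , inj₂-injective e)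
if-inj false false _ _ _ _ e = inj₁ (inj₁-injective e)
if-inj true  false _ _ _ _ ()
if-inj false true  _ _ _ _ ()

merge-inv : ∀ {m} (a a′ : Fin (5 + m)) {b b′} → merge a b ≡ merge a′ b′ →
            a ≡ a′ ⊎ (Mid (toℕ a) × Mid (toℕ a′) × b ≡ b′)
merge-inv a a′ {b} {b′} same = if-inj (isMid (toℕ a)) (isMid (toℕ a′)) a a′ b b′
  (trans (sym (unmerge-merge a b)) (trans (cong unmerge same) (unmerge-merge a′ b′)))

fewerColours : ∀ {n m} (G : Graph n) → ¬ Clique G 3 → PackingColoring G (5 + m) →
               ProperColoring G (3 + m)
fewerColours G noK₃ (c , packing) = (λ v → merge (c v) (colour v)) , proper
  where
  open MiddleClasses G c packing (triangleFree G noK₃)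
  proper : ∀ u v → Adj G u v → merge (c u) (colour u) ≢ merge (c v) (colour v)
  proper u v uv same =
    either (packing-proper G c packing uv) middleSameSide
           (merge-inv (c u) (c v) {colour u} {colour v} same)
    where
    middleSameSide : ¬ (Mid (index u) × Mid (index v) × colour u ≡ colour v)
    middleSameSide (mu , mv , sameColour) = colour-proper (uv , mu , mv) sameColour

theorem3p4 : (k : ℕ) → 4 ≤ k → ¬ Realizable 2 k (suc k)
theorem3p4 (suc (suc (suc (suc m)))) (s≤s (s≤s (s≤s (s≤s z≤n))))
  (_ , G , (_ , noK₃) , (_ , χ-minimal) , (packingColouring , _)) =
  χ-minimal (3 + m) (n<1+n _) (fewerColours G noK₃ packingColouring)
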